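{- Let $F$ be an eligible $3$-uniform hypergraph, let $e$ be a positive integer with $e(F)\le e/2$, and suppose that a $3$-uniform hypergraph $\mathcal{H}$ contains an $(r,F)$-sunflower (for some positive integer $r$) with at least $e$ edges. Then $\mathcal{H}$ contains an $(e+\Delta(F),e)$-configuration, i.e. a subhypergraph with at most $e+\Delta(F)$ vertices and at least $e$ edges.
   Context: All hypergraphs are $3$-uniform. For a hypergraph $F$, its deficiency is $\Delta(F)=v(F)-e(F)$; for $U\subseteq V(F)$, $\Delta(U)=\Delta(F[U])$ where $F[U]$ is the induced subhypergraph. An independent set $A\subseteq V(F)$ (one spanning no edge) is good if every set $U$ with $A\subsetneq U\subseteq V(F)$ satisfies $\Delta(U)\ge |A|+1$. A hypergraph $F$ with $\Delta(F)=k\ge 1$ is eligible if: (i) there are two disjoint good sets $A,B\subseteq V(F)$ with $|A|=|B|=k-1$; (ii) there exist two distinct vertices $u,v\in V(F)\setminus(A\cup B)$; (iii) at most $e(F)/4-k$ vertices of $F$ have degree more than $1$, every edge of $F$ contains at most one vertex of degree $1$, and $F$ has no isolated vertices; (iv) every $U\subseteq V(F)$ with $|U|\ge 2$ satisfies $\Delta(U)\ge 2$. An embedding of $F$ into a hypergraph $\tilde F$ is an injective map $\varphi:V(F)\to V(\tilde F)$ mapping edges of $F$ to edges of $\tilde F$. For a positive integer $r$, a hypergraph $\tilde F$ is an $(r,F)$-sunflower if there exist a set $U\subsetneq V(F)$ with $\Delta(U)\ge \Delta(F)$ and $r$ embeddings $\varphi_1,\dots,\varphi_r$ of $F$ into $\tilde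 F$ such that $\tilde F$ is the union of the images $\varphi_1(F),\dots,\varphi_r(F)$ (in particular $\bigcup_i\varphi_i(V(F))=V(\tilde F)$), and for $1\le i<j\le r$ we have $\varphi_i(u)=\varphi_j(v)$ if and only if $u=v\in U$. "Contains" means as a (not necessarily induced) subhypergraph. -}

module Defs where

open import Data.Nat using (ℕ; _≤_; _∸_; suc; _≤?_)
open import Data.Integer using (ℤ; +_; _-_; _*_) renaming (_≤_ to _≤ℤ_)
open import Data.Fin using (Fin) renaming (_<_ to _<ᶠ_)
open import Data.Fin.Subset using (Subset; _∈_; _∉_; _⊆_; _⊂_; ∣_∣; _∪_; ⊤)
open import Data.Fin.Subset.Properties using (_⊆?_; _∈?_)
open import Data.List using (List; length; filter; allFin)
open import Data.List.Membership.Propositional using () renaming (_∈_ to _∈ˡ_)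
open import Data.List.Relation.Unary.All using (All)
open import Data.List.Relation.Unary.Unique.Propositional using (Unique)
open import Data.Product using (Σ; ∃; ∃-syntax; _×_; _,_)
open import Relation.Binary.PropositionalEquality using (_≡_; _≢_)
open import Relation.Nullary using (¬_)
open import Function.Definitions using (Injective)
open import Function.Bundles using (_⇔_)

record Hyp : Set where
  field
    n       : ℕ
    edges   : List (Subset n)
    uniform : All (λ e → ∣ e ∣ ≡ 3) edges
    simple  : Unique edges
open Hyp public

v : Hyp → ℕ
v F = n F

e : Hyp → ℕ
e F = length (edges F)

eInd : (F : Hyp) → Subset (n F) → ℕ
eInd F U = length (filter (_⊆? U) (edges F))

Δ : Hyp → ℤ
Δ F = + v F - + e F

ΔU : (F : Hyp) → Subset (n F) → ℤ
ΔU F U = + ∣ U ∣ - + eInd F U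

deg : (F : Hyp) → Fin (n F) → ℕ
deg F x = length (filter (x ∈?_) (edges F))

highDegCount : Hyp → ℕ
highDegCount F = length (filter (λ x → 2 ≤? deg F x) (allFin (n F)))

Independent : (F : Hyp) → Subset (n F) → Set
Independent F A = ∀ {t} → t ∈ˡ edges F → ¬ (t ⊆ A)

Good : (F : Hyp) → Subset (n F) → Set
Good F A = Independent F A × (∀ U → A ⊂ U → + suc ∣ A ∣ ≤ℤ ΔU F U)

Disjoint : ∀ {m} → Subset m → Subset m → Set
Disjoint A B = ∀ x → x ∈ A → x ∉ B

Eligible : Hyp → Set
Eligible F = ∃[ k ] (Δ F ≡ + k × 1 ≤ k
  × (∃[ A ] ∃[ B ] (Good F A × Good F B × Disjoint A B
       × ∣ A ∣ ≡ k ∸ 1 × ∣ B ∣ ≡ k ∸ 1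
       × ∃[ u ] ∃[ w ] (u ≢ w × u ∉ (A ∪ B) × w ∉ (A ∪ B))))
  -- (iii): #{vertices of degree > 1} ≤ e(F)/4 - k, i.e. 4·# ≤ e(F) - 4k
  × (+ 4 * + highDegCount F ≤ℤ + e F - + 4 * + k)
  × (∀ {t} → t ∈ˡ edges F → ∀ x y → x ∈ t → y ∈ t → deg F x ≡ 1 → deg F y ≡ 1 → x ≡ y)
  × (∀ x → 1 ≤ deg F x)
  × (∀ U → 2 ≤ ∣ U ∣ → + 2 ≤ℤ ΔU F U))

IsImage : ∀ {a b} → (Fin a → Fin b) → Subset a → Subset b → Set
IsImage φ s t = ∀ y → (y ∈ t ⇔ (∃[ x ] (x ∈ s × φ x ≡ y)))

record Embedding (F G : Hyp) : Set where
  field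
    φ     : Fin (n F) → Fin (n G)
    inj   : Injective _≡_ _≡_ φ
    edge  : ∀ {s} → s ∈ˡ edges F → ∃[ t ] (t ∈ˡ edges G × IsImage φ s t)
open Embedding public

Contains : Hyp → Hyp → Set
Contains G F = Embedding F G

IsSunflower : ℕ → Hyp → Hyp → Set
IsSunflower r F G =
  ∃[ U ] (U ⊂ ⊤ × Δ F ≤ℤ ΔU F U
    × Σ (Fin r → Embedding F G) λ emb →
        (∀ y → ∃[ i ] ∃[ x ] (φ (emb i) x ≡ y))
      × (∀ {t} → t ∈ˡ edges G → ∃[ i ] ∃[ s ] (s ∈ˡ edges F × IsImage (φ (emb i)) s t))
      × (∀ i j → i <ᶠ j → ∀ x y →
           ((φ (emb i) x ≡ φ (emb j) y) ⇔ (x ≡ y × x ∈ U))))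

-- Let U be the core of the sunflower, d the number of edges of F not inside U, and r = r′ + 1.
-- Petals meet only in U, so e(G) ≤ e(F) + r′d and e lies in (e(F) + td, e(F) + (t+1)d] for some
-- t < r′. Take all of petal 0, the parts outside U of petals 1..t and part of petal t+1. A part
-- outside U has d edges and, since Δ(U) ≥ Δ(F), at most d vertices, so the vertex surplus stays
-- Δ(F). To hit e edges exactly, petal t+1 contributes its crossing edges free of pendant vertices
-- outside U plus i edges at such pendants (one new vertex each), while petal 0 may shed j pendant
-- vertices with their edges; condition (iii) provides enough pendants for this to balance.

module Submission where

open import Data.Bool using (true; false)
import Data.Bool as Bool
open import Data.Bool.Properties using (T-≡)
open import Data.Empty using (⊥-elim)
open import Data.Fin using (Fin; zero; suc; toℕ; fromℕ<) renaming (_≟_ to _≟ᶠ_; _<_ to _<ᶠ_)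
open import Data.Fin.Properties using (any?; toℕ-fromℕ<) renaming (<-cmp to <-cmpᶠ)
open import Data.Fin.Subset using (Subset; _∈_; _∉_; _⊆_; ∣_∣)
open import Data.Fin.Subset.Properties using (_∈?_; _⊆?_; ⊆-antisym)
open import Data.Integer using (_-_; +≤+) renaming (+_ to pos; _+_ to _+ℤ_; _≤_ to _≤ℤ_)
import Data.Integer.Properties as ℤ
open import Data.Integer.Tactic.RingSolver using () renaming (solve-∀ to ℤ-solve-∀)
open import Data.List
  using (List; []; _∷_; _++_; length; map; filter; take; allFin; applyUpTo; cartesianProduct)
open import Data.List.Properties
  using (length-filter; length-take; length-applyUpTo; length-++; length-map; length-tabulate; map-tabulate)
open import Data.List.Membership.Propositional using (find; lose) renaming (_∈_ to _∈ˡ_)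
open import Data.List.Membership.Propositional.Properties
  using ( ∈-∃++; ∈-applyUpTo⁺; ∈-applyUpTo⁻; ∈-map⁻; ∈-map⁺; ∈-cartesianProduct⁺; ∈-cartesianProduct⁻
        ; ∈-++⁻; ∈-++⁺ˡ; ∈-++⁺ʳ; ∈-filter⁻; ∈-filter⁺; ∈-allFin)
open import Data.List.Relation.Binary.Disjoint.Propositional using () renaming (Disjoint to Disjointˡ)
open import Data.List.Relation.Binary.Subset.Propositional using () renaming (_⊆_ to _⊆ˡ_)
open import Data.List.Relation.Unary.All as All using ([]; _∷_)
open import Data.List.Relation.Unary.All.Properties using () renaming (map⁺ to All-map⁺)
open import Data.List.Relation.Unary.Any as Any using (here; there)
open import Data.List.Relation.Unary.Unique.Propositional using (Unique; []; _∷_)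
import Data.List.Relation.Unary.Unique.Propositional.Properties as Unique
open import Data.Nat using (ℕ; zero; suc; _+_; _*_; _∸_; _≤_; _<_; z≤n; s≤s; z<s; _≟_; _≤?_)
open import Data.Nat.Properties
  using ( ≤-refl; ≤-reflexive; ≤-trans; ≤-antisym; <⇒≤; <⇒≢; <⇒≱; ≰⇒>; ≤∧≢⇒<; n<1+n; m<n⇒m<1+n
        ; suc-injective; 0≢1+n; +-identityʳ; +-comm; +-assoc; +-suc; m≤m+n; m≤n+m; m<m+n; m≤n*m
        ; +-mono-≤; +-monoˡ-≤; +-monoʳ-≤; +-cancelˡ-≤; +-cancelʳ-≤; *-monoʳ-≤
        ; m+[n∸m]≡n; m≤n⇒∃[o]m+o≡n; m⊓n≤n; m≤n⇒m⊓n≡m; module ≤-Reasoning)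
open import Data.Nat.Tactic.RingSolver using (solve-∀)
open import Data.Product using (∃-syntax; _×_; _,_; proj₁; proj₂)
open import Data.Sum using (_⊎_; inj₁; inj₂)
import Data.Vec as Vec
open import Data.Vec.Properties using (≡-dec; lookup∘tabulate; []=⇒lookup; lookup⇒[]=)
open import Function using (id; _∘_; Equivalence; mk⇔; _⇔_)
open import Function.Definitions using (Injective)
open import Level using (0ℓ)
open import Relation.Binary using (tri<; tri≈; tri>)
open import Relation.Binary.PropositionalEquality
  using (_≡_; _≢_; refl; sym; trans; cong; cong₂; subst; subst₂; module ≡-Reasoning)
open import Relation.Nullary using (¬_; does; isYes; yes; no; ¬?)
open import Relation.Nullary.Decidable using (_×-dec_; _⊎-dec_; toWitness; fromWitness; decidable-stable)
open import Relation.Unary using (Pred; Decidable)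

open import Defs

private variable
  A B : Set

unique-⊆⇒length-≤ : {xs ys : List A} → Unique xs → xs ⊆ˡ ys → length xs ≤ length ys
unique-⊆⇒length-≤ {xs = []} _ _ = z≤n
unique-⊆⇒length-≤ {xs = x ∷ xs} {ys} (x∉xs ∷ xs!) xs⊆ys
  with us , vs , refl ← ∈-∃++ (xs⊆ys (here refl)) = begin
    suc (length xs)           ≤⟨ s≤s (unique-⊆⇒length-≤ xs! xs⊆us++vs) ⟩
    suc (length (us ++ vs))   ≡⟨ cong suc (length-++ us) ⟩
    suc (length us + length vs) ≡⟨ sym (+-suc (length us) (length vs)) ⟩
    length us + length (x ∷ vs) ≡⟨ sym (length-++ us) ⟩
    length (us ++ x ∷ vs)     ∎
  where
  open ≤-Reasoning
  xs⊆us++vs : xs ⊆ˡ us ++ vs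
  xs⊆us++vs {z} z∈xs with ∈-++⁻ us (xs⊆ys (there z∈xs))
  ... | inj₁ z∈us = ∈-++⁺ˡ z∈us
  ... | inj₂ (here refl) = ⊥-elim (All.lookup x∉xs z∈xs refl)
  ... | inj₂ (there z∈vs) = ∈-++⁺ʳ us z∈vs

nonempty⇒∃∈ : (xs : List A) → 1 ≤ length xs → ∃[ a ] a ∈ˡ xs
nonempty⇒∃∈ (a ∷ _) _ = a , here refl

map⁺-injectiveOn : (f : A → B) {xs : List A} → Unique xs →
  (∀ {x y} → x ∈ˡ xs → y ∈ˡ xs → f x ≡ f y → x ≡ y) → Unique (map f xs)
map⁺-injectiveOn f {[]} _ _ = []
map⁺-injectiveOn f {x ∷ xs} (x∉xs ∷ xs!) inj =
  All-map⁺ (All.tabulate λ y∈xs fx≡fy → All.lookup x∉xs y∈xs (inj (here refl) (there y∈xs) fx≡fy))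
  ∷ map⁺-injectiveOn f xs! (λ p q → inj (there p) (there q))

take⊆ : ∀ k (xs : List A) → take k xs ⊆ˡ xs
take⊆ (suc k) (x ∷ xs) (here refl) = here refl
take⊆ (suc k) (x ∷ xs) (there p) = there (take⊆ k xs p)

length-take-≤ : ∀ {k} (xs : List A) → k ≤ length xs → length (take k xs) ≡ k
length-take-≤ {k = k} xs k≤ = trans (length-take k xs) (m≤n⇒m⊓n≡m k≤)

tagged : {C : Set} → ℕ → List C → List (ℕ × C)
tagged q = map (q ,_)

tag≡ : ∀ {C : Set} {q} {xs : List C} {p} → p ∈ˡ tagged q xs → proj₁ p ≡ q
tag≡ p∈ = let _ , _ , p≡ = ∈-map⁻ _ p∈ in cong proj₁ p≡

tagged! : ∀ {C : Set} {q} {xs : List C} → Unique xs → Unique (tagged q xs)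
tagged! = Unique.map⁺ (cong proj₂)

length-tagged : ∀ {C : Set} q (xs : List C) → length (tagged q xs) ≡ length xs
length-tagged q = length-map (q ,_)

length-cartesianProduct : (xs : List A) (ys : List B) →
  length (cartesianProduct xs ys) ≡ length xs * length ys
length-cartesianProduct [] ys = refl
length-cartesianProduct (x ∷ xs) ys = begin
  length (map (x ,_) ys ++ cartesianProduct xs ys)
    ≡⟨ length-++ (map (x ,_) ys) ⟩
  length (map (x ,_) ys) + length (cartesianProduct xs ys)
    ≡⟨ cong₂ _+_ (length-map (x ,_) ys) (length-cartesianProduct xs ys) ⟩
  length ys + length xs * length ys
    ∎
  where open ≡-Reasoning

module _ {n : ℕ} where

  select : {P : Pred (Fin n) 0ℓ} → Decidable P → Subset n
  select P? = Vec.tabulate (isYes ∘ P?)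

  module _ {P : Pred (Fin n) 0ℓ} (P? : Decidable P) {x : Fin n} where

    ∈-select⁻ : x ∈ select P? → P x
    ∈-select⁻ x∈ = toWitness {a? = P? x} (Equivalence.from T-≡
      (trans (sym (lookup∘tabulate (isYes ∘ P?) x)) ([]=⇒lookup x∈)))

    ∈-select⁺ : P x → x ∈ select P?
    ∈-select⁺ px = lookup⇒[]= x _
      (trans (lookup∘tabulate (isYes ∘ P?) x) (Equivalence.to T-≡ (fromWitness {a? = P? x} px)))

  fromList : List (Fin n) → Subset n
  fromList xs = select (λ y → Any.any? (y ≟ᶠ_) xs)

  ∈-fromList⁻ : ∀ {xs x} → x ∈ fromList xs → x ∈ˡ xs
  ∈-fromList⁻ {xs} = ∈-select⁻ (λ y → Any.any? (y ≟ᶠ_) xs)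

  ∈-fromList⁺ : ∀ {xs x} → x ∈ˡ xs → x ∈ fromList xs
  ∈-fromList⁺ {xs} = ∈-select⁺ (λ y → Any.any? (y ≟ᶠ_) xs)

length-filter-∈?-suc : ∀ {n} b (p : Subset n) (xs : List (Fin n)) →
  length (filter (_∈? (b Vec.∷ p)) (map suc xs)) ≡ length (filter (_∈? p) xs)
length-filter-∈?-suc b p [] = refl
length-filter-∈?-suc b p (x ∷ xs) with does (x ∈? p)
... | true = cong suc (length-filter-∈?-suc b p xs)
... | false = length-filter-∈?-suc b p xs

∣p∣≡length-members : ∀ {n} (p : Subset n) → ∣ p ∣ ≡ length (filter (_∈? p) (allFin n))
∣p∣≡length-members {zero} Vec.[] = refl
∣p∣≡length-members {suc n} (b Vec.∷ p) = trans (members-∷ b)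
  (cong (λ xs → length (filter (_∈? (b Vec.∷ p)) (zero ∷ xs))) (map-tabulate id suc))
  where
  members-∷ : ∀ b → ∣ b Vec.∷ p ∣ ≡ length (filter (_∈? (b Vec.∷ p)) (zero ∷ map suc (allFin n)))
  members-∷ true = cong suc (trans (∣p∣≡length-members p) (sym (length-filter-∈?-suc true p (allFin n))))
  members-∷ false = trans (∣p∣≡length-members p) (sym (length-filter-∈?-suc false p (allFin n)))

∣fromList∣≤length : ∀ {n} (xs : List (Fin n)) → ∣ fromList xs ∣ ≤ length xs
∣fromList∣≤length {n} xs = ≤-trans (≤-reflexive (∣p∣≡length-members (fromList xs)))
  (unique-⊆⇒length-≤ (Unique.filter⁺ (_∈? fromList xs) (Unique.allFin⁺ n))
    (∈-fromList⁻ ∘ proj₂ ∘ ∈-filter⁻ (_∈? fromList xs) {xs = allFin n}))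

⊈⇒∃∉ : ∀ {n} {t u : Subset n} → ¬ t ⊆ u → ∃[ x ] (x ∈ t × x ∉ u)
⊈⇒∃∉ {t = t} {u} t⊈u with any? (λ x → x ∈? t ×-dec ¬? (x ∈? u))
... | yes w = w
... | no ∄ = ⊥-elim (t⊈u λ {x} x∈t → decidable-stable (x ∈? u) (λ x∉u → ∄ (x , x∈t , x∉u)))

module _ {a b : ℕ} where

  image : (Fin a → Fin b) → Subset a → Subset b
  image φ s = select (λ y → any? λ x → x ∈? s ×-dec φ x ≟ᶠ y)

  ∈-image⁻ : ∀ φ {s y} → y ∈ image φ s → ∃[ x ] (x ∈ s × φ x ≡ y)
  ∈-image⁻ φ {s} = ∈-select⁻ (λ y → any? λ x → x ∈? s ×-dec φ x ≟ᶠ y)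

  ∈-image⁺ : ∀ φ {s x} → x ∈ s → φ x ∈ image φ s
  ∈-image⁺ φ {s} {x} x∈s = ∈-select⁺ (λ y → any? λ x → x ∈? s ×-dec φ x ≟ᶠ y) (x , x∈s , refl)

  IsImage⇒≡image : ∀ {φ s t} → IsImage φ s t → t ≡ image φ s
  IsImage⇒≡image {φ} {s} {t} t≈φs = ⊆-antisym
    (λ {y} y∈t → ∈-select⁺ (λ y → any? λ x → x ∈? s ×-dec φ x ≟ᶠ y)
                             (Equivalence.to (t≈φs y) y∈t))
    (λ {y} y∈φs → Equivalence.from (t≈φs y) (∈-image⁻ φ y∈φs))

  image-cong : ∀ {φ ψ s} → (∀ {x} → x ∈ s → φ x ≡ ψ x) → image φ s ≡ image ψ s
  image-cong {φ} {ψ} φ≗ψ = ⊆-antisym (transfer φ≗ψ) (transfer (sym ∘ φ≗ψ))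
    where
    transfer : ∀ {φ ψ s} → (∀ {x} → x ∈ s → φ x ≡ ψ x) → image φ s ⊆ image ψ s
    transfer {φ} {ψ} φ≗ψ y∈ with x , x∈s , refl ← ∈-image⁻ φ y∈ =
      subst (_∈ image ψ _) (sym (φ≗ψ x∈s)) (∈-image⁺ ψ x∈s)

  image-injective : ∀ {φ} → Injective _≡_ _≡_ φ → ∀ {s t} → image φ s ≡ image φ t → s ≡ t
  image-injective {φ} φ-inj φs≡φt = ⊆-antisym (reflect φs≡φt) (reflect (sym φs≡φt))
    where
    reflect : ∀ {s t} → image φ s ≡ image φ t → s ⊆ t
    reflect {s} {t} eq x∈s
      with x′ , x′∈t , φx′≡φx ← ∈-image⁻ φ (subst (_ ∈_) eq (∈-image⁺ φ x∈s)) =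
      subst (_∈ t) (φ-inj φx′≡φx) x′∈t

IsImage-∘ : ∀ {a b c} {φ : Fin a → Fin b} {ψ : Fin b → Fin c} {s t u} →
  IsImage φ s t → IsImage ψ t u → u ≡ image (ψ ∘ φ) s
IsImage-∘ {φ = φ} {ψ} t≈φs u≈ψt = IsImage⇒≡image λ z → mk⇔
  (λ z∈u → let y , y∈t , ψy≡z = Equivalence.to (u≈ψt z) z∈u
               x , x∈s , φx≡y = Equivalence.to (t≈φs y) y∈t
           in x , x∈s , trans (cong ψ φx≡y) ψy≡z)
  (λ { (x , x∈s , ψφx≡z) →
        Equivalence.from (u≈ψt z) (φ x , Equivalence.from (t≈φs (φ x)) (x , x∈s , refl) , ψφx≡z) })

crossingEdges : (F : Hyp) → Subset (n F) → List (Subset (n F))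
crossingEdges F U = filter (λ s → ¬? (s ⊆? U)) (edges F)

record Sunflower (F H : Hyp) (U : Subset (n F)) (m : ℕ) : Set where
  field
    petal         : ℕ → Fin (n F) → Fin (n H)
    petal-inj     : ∀ {q} → q ≤ m → Injective _≡_ _≡_ (petal q)
    petal-edge    : ∀ {q} → q ≤ m → ∀ {s} → s ∈ˡ edges F → image (petal q) s ∈ˡ edges H
    petals-meet   : ∀ {q q′} → q ≤ m → q′ ≤ m → q ≢ q′ →
                    ∀ {x y} → petal q x ≡ petal q′ y → x ∈ U
    petal-on-core : ∀ {q} → q ≤ m → ∀ {x} → x ∈ U → petal q x ≡ petal 0 x

module _ {F H : Hyp} {U : Subset (n F)} {m : ℕ} (S : Sunflower F H U m) where
  open Sunflower S

  petalᵛ : ℕ × Fin (n F) → Fin (n H)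
  petalᵛ (q , x) = petal q x

  petalᵉ : ℕ × Subset (n F) → Subset (n H)
  petalᵉ (q , s) = image (petal q) s

  -- An edge of F inside the core is only ever counted in petal 0.
  CountedEdge : ℕ × Subset (n F) → Set
  CountedEdge (q , s) = s ∈ˡ edges F × q ≤ m × (q ≢ 0 → ¬ s ⊆ U)

  private
    petals-disjointᵉ : ∀ {q q′ s s′} → q ≤ m → q′ ≤ m → q ≢ q′ → ¬ s ⊆ U →
      image (petal q) s ≢ image (petal q′) s′
    petals-disjointᵉ q≤m q′≤m q≢q′ s⊈U eq with x , x∈s , x∉U ← ⊈⇒∃∉ s⊈U
      with _ , _ , eq′ ← ∈-image⁻ (petal _) (subst (_ ∈_) eq (∈-image⁺ (petal _) x∈s)) =
      x∉U (petals-meet q≤m q′≤m q≢q′ (sym eq′))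

  petalᵉ-injectiveOn : ∀ {p p′} → CountedEdge p → CountedEdge p′ → petalᵉ p ≡ petalᵉ p′ → p ≡ p′
  petalᵉ-injectiveOn {q , s} {q′ , s′} (_ , q≤m , ⊈U) (_ , q′≤m , ⊈U′) eq with q ≟ q′
  ... | yes refl = cong (q ,_) (image-injective (petal-inj q≤m) eq)
  ... | no q≢q′ with q ≟ 0
  ...   | no q≢0 = ⊥-elim (petals-disjointᵉ q≤m q′≤m q≢q′ (⊈U q≢0) eq)
  ...   | yes refl = ⊥-elim (petals-disjointᵉ q′≤m q≤m (q≢q′ ∘ sym) (⊈U′ (q≢q′ ∘ sym)) (sym eq))

  sunflower-induced-edges : (TL : List (ℕ × Subset (n F))) (VL : List (ℕ × Fin (n F))) → Unique TL →
    (∀ {p} → p ∈ˡ TL → CountedEdge p) →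
    (∀ {q s} → (q , s) ∈ˡ TL → ∀ {x} → x ∈ s → petal q x ∈ˡ map petalᵛ VL) →
    length TL ≤ eInd H (fromList (map petalᵛ VL))
  sunflower-induced-edges TL VL TL! counted covered = begin
    length TL            ≡⟨ length-map petalᵉ TL ⟨
    length (map petalᵉ TL) ≤⟨ unique-⊆⇒length-≤
                                (map⁺-injectiveOn petalᵉ TL! λ p q → petalᵉ-injectiveOn (counted p) (counted q))
                                image∈induced ⟩
    eInd H W             ∎
    where
    open ≤-Reasoning
    W = fromList (map petalᵛ VL)
    image∈induced : map petalᵉ TL ⊆ˡ filter (_⊆? W) (edges H)
    image∈induced z∈ with (q , s) , p∈TL , refl ← ∈-map⁻ petalᵉ z∈ =
      ∈-filter⁺ (_⊆? W) (petal-edge (proj₁ (proj₂ (counted p∈TL))) (proj₁ (counted p∈TL)))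
        λ y∈ → let x , x∈s , eq = ∈-image⁻ (petal q) y∈ in
               ∈-fromList⁺ (subst (_∈ˡ map petalᵛ VL) eq (covered p∈TL x∈s))

module _ {F G : Hyp} {r′ : ℕ} {U : Subset (n F)} (emb : Fin (suc r′) → Embedding F G)
  (meet : ∀ i j → i <ᶠ j → ∀ x y → ((φ (emb i) x ≡ φ (emb j) y) ⇔ (x ≡ y × x ∈ U)))
  where

  private
    φ₀ : Fin (n F) → Fin (n G)
    φ₀ = φ (emb zero)

    emb-on-core : ∀ i {x} → x ∈ U → φ (emb i) x ≡ φ₀ x
    emb-on-core zero _ = refl
    emb-on-core (suc i) {x} x∈U = sym (Equivalence.from (meet zero (suc i) z<s x x) (refl , x∈U))

  -- Petal 0 contributes all of F; every other petal only its crossing edges.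
  sunflower-edges≤ : (∀ {t} → t ∈ˡ edges G → ∃[ i ] ∃[ s ] (s ∈ˡ edges F × IsImage (φ (emb i)) s t)) →
    e G ≤ e F + r′ * length (crossingEdges F U)
  sunflower-edges≤ covered = begin
    e G
      ≤⟨ unique-⊆⇒length-≤ (simple G) edge∈petals ⟩
    length (map (image φ₀) (edges F) ++ map outerImage outer)
      ≡⟨ length-++ (map (image φ₀) (edges F)) ⟩
    length (map (image φ₀) (edges F)) + length (map outerImage outer)
      ≡⟨ cong₂ _+_ (length-map _ (edges F)) (length-map _ outer) ⟩
    e F + length outer
      ≡⟨ cong (e F +_) (length-cartesianProduct (allFin r′) crossing) ⟩
    e F + length (allFin r′) * length crossing
      ≡⟨ cong (λ k → e F + k * length crossing) (length-tabulate {n = r′} id) ⟩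
    e F + r′ * length crossing
      ∎
    where
    open ≤-Reasoning
    crossing : List (Subset (n F))
    crossing = crossingEdges F U
    outer : List (Fin r′ × Subset (n F))
    outer = cartesianProduct (allFin r′) crossing
    outerImage : Fin r′ × Subset (n F) → Subset (n G)
    outerImage (c , s) = image (φ (emb (suc c))) s
    edge∈petals : edges G ⊆ˡ map (image φ₀) (edges F) ++ map outerImage outer
    edge∈petals t∈G with covered t∈G
    ... | i , s , s∈F , t≈ with IsImage⇒≡image t≈
    ... | refl with i
    ...   | zero = ∈-++⁺ˡ (∈-map⁺ (image φ₀) s∈F)
    ...   | suc c with s ⊆? U
    ...     | yes s⊆U = ∈-++⁺ˡ (subst (_∈ˡ map (image φ₀) (edges F))
                          (image-cong (λ x∈s → sym (emb-on-core (suc c) (s⊆U x∈s))))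
                          (∈-map⁺ (image φ₀) s∈F))
    ...     | no s⊈U = ∈-++⁺ʳ (map (image φ₀) (edges F)) (∈-map⁺ outerImage
                          (∈-cartesianProduct⁺ (∈-allFin c) (∈-filter⁺ (λ s → ¬? (s ⊆? U)) s∈F s⊈U)))

  -- Petals with index beyond r′ are junk copies of petal r′.
  sunflower-in : ∀ {H} → Embedding G H → Sunflower F H U r′
  sunflower-in {H} ψ = record
    { petal         = petal
    ; petal-inj     = λ _ → inj (emb _) ∘ inj ψ
    ; petal-edge    = petal-edge
    ; petals-meet   = petals-meet
    ; petal-on-core = λ _ x∈U → cong (φ ψ) (emb-on-core _ x∈U)
    }
    where
    index : ℕ → Fin (suc r′)
    index q = fromℕ< (s≤s (m⊓n≤n q r′))
    toℕ-index : ∀ {q} → q ≤ r′ → toℕ (index q) ≡ q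
    toℕ-index {q} q≤r′ = trans (toℕ-fromℕ< (s≤s (m⊓n≤n q r′))) (m≤n⇒m⊓n≡m q≤r′)
    petal : ℕ → Fin (n F) → Fin (n H)
    petal q x = φ ψ (φ (emb (index q)) x)
    petal-edge : ∀ {q} → q ≤ r′ → ∀ {s} → s ∈ˡ edges F → image (petal q) s ∈ˡ edges H
    petal-edge {q} _ s∈F with t , t∈G , t≈ ← edge (emb (index q)) s∈F
      with u , u∈H , u≈ ← edge ψ t∈G = subst (_∈ˡ edges H) (IsImage-∘ t≈ u≈) u∈H
    petals-meet : ∀ {q q′} → q ≤ r′ → q′ ≤ r′ → q ≢ q′ →
                  ∀ {x y} → petal q x ≡ petal q′ y → x ∈ U
    petals-meet {q} {q′} q≤ q′≤ q≢q′ {x} {y} eq with <-cmpᶠ (index q) (index q′)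
    ... | tri< lt _ _ = proj₂ (Equivalence.to (meet _ _ lt x y) (inj ψ eq))
    ... | tri≈ _ same _ =
      ⊥-elim (q≢q′ (trans (sym (toℕ-index q≤)) (trans (cong toℕ same) (toℕ-index q′≤))))
    ... | tri> _ _ gt with refl , y∈U ← Equivalence.to (meet _ _ gt y x) (sym (inj ψ eq)) = y∈U

∃-block : ∀ a d b {x} → a < x → x ≤ a + b * d →
  ∃[ t ] ∃[ m ] (t < b × m ≤ d × a + t * d + m ≡ x)
∃-block a d zero a<x x≤a = ⊥-elim (<⇒≱ a<x (≤-trans x≤a (≤-reflexive (+-identityʳ a))))
∃-block a d (suc b) {x} a<x x≤ with x ≤? a + b * d
... | yes x≤′ = let t , m , t<b , rest = ∃-block a d b a<x x≤′ in t , m , m<n⇒m<1+n t<b , rest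
... | no x≰ with o , eq ← m≤n⇒∃[o]m+o≡n (≰⇒> x≰) = b , suc o , n<1+n b , m≤d , ends
  where
  open ≤-Reasoning
  ends : a + b * d + suc o ≡ x
  ends = trans (+-suc (a + b * d) o) eq
  rearrange : ∀ a b d → a + (d + b * d) ≡ a + b * d + d
  rearrange = solve-∀
  m≤d : suc o ≤ d
  m≤d = +-cancelˡ-≤ (a + b * d) _ _ (begin
    a + b * d + suc o ≡⟨ ends ⟩
    x                 ≤⟨ x≤ ⟩
    a + (d + b * d)   ≡⟨ rearrange a b d ⟩
    a + b * d + d     ∎)

∃-last-petal : ∀ {m Nn P} R → m ≤ Nn + P →
  ∃[ i ] ∃[ j ] (i ≤ P × j ≤ R × m + j ≤ Nn + i × (Nn + i ≤ m + j ⊎ (i ≡ 0 × j ≡ R)))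
∃-last-petal {m} {Nn} {P} R m≤ with Nn ≤? m
... | yes Nn≤m = m ∸ Nn , 0 , i≤P , z≤n , ≤-reflexive balanced , inj₁ (≤-reflexive (sym balanced))
  where
  balanced : m + 0 ≡ Nn + (m ∸ Nn)
  balanced = trans (+-identityʳ m) (sym (m+[n∸m]≡n Nn≤m))
  i≤P : m ∸ Nn ≤ P
  i≤P = +-cancelˡ-≤ Nn _ _ (≤-trans (≤-reflexive (m+[n∸m]≡n Nn≤m)) m≤)
... | no Nn≰m with m≤Nn ← <⇒≤ (≰⇒> Nn≰m) | Nn ∸ m ≤? R
...   | yes j≤R = 0 , Nn ∸ m , z≤n , j≤R , ≤-reflexive balanced , inj₁ (≤-reflexive (sym balanced))
  where
  balanced : m + (Nn ∸ m) ≡ Nn + 0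
  balanced = trans (m+[n∸m]≡n m≤Nn) (sym (+-identityʳ Nn))
...   | no j≰R = 0 , R , z≤n , ≤-refl , m+R≤Nn , inj₂ (refl , refl)
  where
  open ≤-Reasoning
  m+R≤Nn : m + R ≤ Nn + 0
  m+R≤Nn = begin
    m + R        ≤⟨ +-monoʳ-≤ m (<⇒≤ (≰⇒> j≰R)) ⟩
    m + (Nn ∸ m) ≡⟨ m+[n∸m]≡n m≤Nn ⟩
    Nn           ≡⟨ +-identityʳ Nn ⟨
    Nn + 0       ∎

<-double : ∀ {a b} → 1 ≤ a → 2 * a ≤ b → a < b
<-double {a} 1≤a 2a≤b =
  ≤-trans (m<m+n a 1≤a) (≤-trans (≤-reflexive (cong (a +_) (sym (+-identityʳ a)))) 2a≤b)

-- In the application: a = e(F), d crossing edges, Nn of them without an outer pendant, P outer pendants,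
-- y outer vertices of degree ≥ 2, R removable pendants; t full middle petals, i pendant edges in
-- the last petal and j pendants dropped from petal 0.
petal-budget : ∀ {a d Nn P y R ee r′} → d ≡ Nn + P → P + y ≤ d → y + (P + y) ≤ d + R →
  d ≤ a → 1 ≤ a → 2 * a ≤ ee → ee ≤ a + r′ * d →
  ∃[ t ] ∃[ i ] ∃[ j ] (t < r′ × i ≤ P × j ≤ R
    × ee + j ≤ a + (Nn + i + t * d) × a + (y + i + t * (P + y)) ≤ ee + j)
petal-budget {a} {d} {Nn} {P} {y} {R} {ee} {r′} d≡ P+y≤d y+P+y≤d+R d≤a 1≤a 2a≤ee ee≤
  with t , m , t<r′ , m≤d , ee≡ ← ∃-block a d r′ (<-double 1≤a 2a≤ee) ee≤
  with i , j , i≤P , j≤R , m+j≤ , tight ← ∃-last-petal R (subst (m ≤_) d≡ m≤d)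
  = t , i , j , t<r′ , i≤P , j≤R , edges-fit , vertices-fit
  where
  open ≤-Reasoning
  y≤Nn : y ≤ Nn
  y≤Nn = +-cancelˡ-≤ P y Nn (begin
    P + y  ≤⟨ P+y≤d ⟩
    d      ≡⟨ d≡ ⟩
    Nn + P ≡⟨ +-comm Nn P ⟩
    P + Nn ∎)
  edges-fit : ee + j ≤ a + (Nn + i + t * d)
  edges-fit = begin
    ee + j                 ≡⟨ cong (_+ j) ee≡ ⟨
    a + t * d + m + j      ≡⟨ +-assoc (a + t * d) m j ⟩
    a + t * d + (m + j)    ≤⟨ +-monoʳ-≤ (a + t * d) m+j≤ ⟩
    a + t * d + (Nn + i)   ≡⟨ regroup a (t * d) Nn i ⟩
    a + (Nn + i + t * d)   ∎
    where
    regroup : ∀ a b c e → a + b + (c + e) ≡ a + (c + e + b)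
    regroup = solve-∀
  balanced-fit : ∀ {t i j} → Nn + i ≤ m + j → y + i + t * (P + y) ≤ t * d + m + j
  balanced-fit {t} {i} {j} Nn+i≤ = begin
    y + i + t * (P + y) ≤⟨ +-mono-≤ (+-monoˡ-≤ i y≤Nn) (*-monoʳ-≤ t P+y≤d) ⟩
    Nn + i + t * d      ≤⟨ +-monoˡ-≤ (t * d) Nn+i≤ ⟩
    m + j + t * d       ≡⟨ regroup m j (t * d) ⟩
    t * d + m + j       ∎
    where
    regroup : ∀ a b c → a + b + c ≡ c + a + b
    regroup = solve-∀
  -- t = 0 is balanced since then m ≥ a ≥ Nn; otherwise a middle petal's surplus d + R − (P + y)
  -- covers the y vertices of the last petal.
  removal-fit : ∀ t → a + t * d + m ≡ ee → y + 0 + t * (P + y) ≤ t * d + m + R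
  removal-fit zero ee≡′ = balanced-fit {t = 0} (begin
    Nn + 0 ≡⟨ +-identityʳ Nn ⟩
    Nn     ≤⟨ ≤-trans (≤-trans (m≤m+n Nn P) (≤-reflexive (sym d≡))) d≤a ⟩
    a      ≤⟨ +-cancelˡ-≤ a a m (begin
                a + a     ≡⟨ cong (a +_) (+-identityʳ a) ⟨
                2 * a     ≤⟨ 2a≤ee ⟩
                ee        ≡⟨ ee≡′ ⟨
                a + 0 + m ≡⟨ cong (_+ m) (+-identityʳ a) ⟩
                a + m     ∎) ⟩
    m      ≤⟨ m≤m+n m R ⟩
    m + R  ∎)
  removal-fit (suc t′) _ = begin
    y + 0 + (P + y + t′ * (P + y)) ≡⟨ regroup y P t′ ⟩
    y + (P + y) + t′ * (P + y)     ≤⟨ +-mono-≤ y+P+y≤d+R (*-monoʳ-≤ t′ P+y≤d) ⟩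
    d + R + t′ * d                 ≤⟨ m≤m+n (d + R + t′ * d) m ⟩
    d + R + t′ * d + m             ≡⟨ regroup′ d R t′ m ⟩
    d + t′ * d + m + R             ∎
    where
    regroup : ∀ y P t → y + 0 + (P + y + t * (P + y)) ≡ y + (P + y) + t * (P + y)
    regroup = solve-∀
    regroup′ : ∀ d R t m → d + R + t * d + m ≡ d + t * d + m + R
    regroup′ = solve-∀
  inner-fit : ∀ {i j} → (Nn + i ≤ m + j ⊎ (i ≡ 0 × j ≡ R)) → y + i + t * (P + y) ≤ t * d + m + j
  inner-fit (inj₁ Nn+i≤) = balanced-fit {t = t} Nn+i≤
  inner-fit (inj₂ (refl , refl)) = removal-fit t ee≡
  vertices-fit : a + (y + i + t * (P + y)) ≤ ee + j
  vertices-fit = begin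
    a + (y + i + t * (P + y)) ≤⟨ +-monoʳ-≤ a (inner-fit tight) ⟩
    a + (t * d + m + j)       ≡⟨ regroup a (t * d) m j ⟩
    a + t * d + m + j         ≡⟨ cong (_+ j) ee≡ ⟩
    ee + j                    ∎
    where
    regroup : ∀ a b c e → a + (b + c + e) ≡ a + b + c + e
    regroup = solve-∀

a+j≤b+c∧b≤d+j⇒a≤d+c : ∀ {a b c d j} → a + j ≤ b + c → b ≤ d + j → a ≤ d + c
a+j≤b+c∧b≤d+j⇒a≤d+c {a} {b} {c} {d} {j} a+j≤ b≤ = +-cancelʳ-≤ j a (d + c) (begin
  a + j     ≤⟨ a+j≤ ⟩
  b + c     ≤⟨ +-monoˡ-≤ c b≤ ⟩
  d + j + c ≡⟨ regroup d j c ⟩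
  d + c + j ∎)
  where
  open ≤-Reasoning
  regroup : ∀ d j c → d + j + c ≡ d + c + j
  regroup = solve-∀

b+j≤a+k∧a+c≤e+j⇒b+c≤e+k : ∀ {a b c e j k} → b + j ≤ a + k → a + c ≤ e + j → b + c ≤ e + k
b+j≤a+k∧a+c≤e+j⇒b+c≤e+k {a} {b} {c} {e} {j} {k} b+j≤ a+c≤ = +-cancelʳ-≤ j (b + c) (e + k) (begin
  b + c + j ≡⟨ regroup b c j ⟩
  b + j + c ≤⟨ +-monoˡ-≤ c b+j≤ ⟩
  a + k + c ≡⟨ regroup a k c ⟩
  a + c + k ≤⟨ +-monoˡ-≤ k a+c≤ ⟩
  e + j + k ≡⟨ regroup e j k ⟩
  e + k + j ∎)
  where
  open ≤-Reasoning
  regroup : ∀ a b c → a + b + c ≡ a + c + b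
  regroup = solve-∀

module PendantStructure (F : Hyp) (U : Subset (n F))
  (deg≥1 : ∀ x → 1 ≤ deg F x)
  (pendants-apart : ∀ {t} → t ∈ˡ edges F → ∀ x y → x ∈ t → y ∈ t →
                    deg F x ≡ 1 → deg F y ≡ 1 → x ≡ y)
  where

  Pendant : Fin (n F) → Set
  Pendant x = deg F x ≡ 1

  pendant? : Decidable Pendant
  pendant? x = deg F x ≟ 1

  pendant-or-heavy : ∀ x → Pendant x ⊎ 2 ≤ deg F x
  pendant-or-heavy x with pendant? x
  ... | yes p = inj₁ p
  ... | no ¬p = inj₂ (≤∧≢⇒< (deg≥1 x) (¬p ∘ sym))

  ¬pendant-heavy : ∀ {x} → Pendant x → ¬ 2 ≤ deg F x
  ¬pendant-heavy p 2≤deg = <⇒≢ 2≤deg (sym p)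

  members : {P : Pred (Fin (n F)) 0ℓ} → Decidable P → List (Fin (n F))
  members P? = filter P? (allFin (n F))

  module _ {P : Pred (Fin (n F)) 0ℓ} (P? : Decidable P) where

    members! : Unique (members P?)
    members! = Unique.filter⁺ P? (Unique.allFin⁺ (n F))

    ∈-members⁺ : ∀ {x} → P x → x ∈ˡ members P?
    ∈-members⁺ {x} = ∈-filter⁺ P? (∈-allFin x)

    ∈-members⁻ : ∀ {x} → x ∈ˡ members P? → P x
    ∈-members⁻ = proj₂ ∘ ∈-filter⁻ P? {xs = allFin (n F)}

  edgesWhere : {P : Pred (Subset (n F)) 0ℓ} → Decidable P → List (Subset (n F))
  edgesWhere P? = filter P? (edges F)

  module _ {P : Pred (Subset (n F)) 0ℓ} (P? : Decidable P) where

    edgesWhere! : Unique (edgesWhere P?)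
    edgesWhere! = Unique.filter⁺ P? (simple F)

    ∈-edgesWhere⁻ : ∀ {t} → t ∈ˡ edgesWhere P? → t ∈ˡ edges F × P t
    ∈-edgesWhere⁻ = ∈-filter⁻ P? {xs = edges F}

  length-vertices : length (allFin (n F)) ≡ n F
  length-vertices = length-tabulate id

  edgeAt : Fin (n F) → Subset (n F)
  edgeAt x = proj₁ (nonempty⇒∃∈ (filter (x ∈?_) (edges F)) (deg≥1 x))

  edgeAt-∈ : ∀ x → edgeAt x ∈ˡ edges F
  edgeAt-∈ x = proj₁ (∈-filter⁻ (x ∈?_) {xs = edges F} (proj₂ (nonempty⇒∃∈ _ (deg≥1 x))))

  ∈-edgeAt : ∀ x → x ∈ edgeAt x
  ∈-edgeAt x = proj₂ (∈-filter⁻ (x ∈?_) {xs = edges F} (proj₂ (nonempty⇒∃∈ _ (deg≥1 x))))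

  pendant⇒edgeAt : ∀ {x t} → Pendant x → t ∈ˡ edges F → x ∈ t → t ≡ edgeAt x
  pendant⇒edgeAt {x} {t} p t∈F x∈t with ≡-dec Bool._≟_ t (edgeAt x)
  ... | yes t≡ = t≡
  ... | no t≢ = ⊥-elim (¬pendant-heavy p (unique-⊆⇒length-≤ ((t≢ ∷ []) ∷ [] ∷ [])
          λ { (here refl) → ∈-filter⁺ (x ∈?_) t∈F x∈t
            ; (there (here refl)) → ∈-filter⁺ (x ∈?_) (edgeAt-∈ x) (∈-edgeAt x) }))

  edgeAt-injectiveOn : ∀ {x x′} → Pendant x → Pendant x′ → edgeAt x ≡ edgeAt x′ → x ≡ x′
  edgeAt-injectiveOn {x} {x′} p p′ eq =
    pendants-apart (edgeAt-∈ x) x x′ (∈-edgeAt x) (subst (x′ ∈_) (sym eq) (∈-edgeAt x′)) p p′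

  -- Dropping a removable pendant from petal 0 loses no vertex used by another petal's crossing edges.
  OuterPendant OuterHeavy Removable Blocked : Fin (n F) → Set
  OuterPendant x = Pendant x × x ∉ U
  OuterHeavy x = x ∉ U × 2 ≤ deg F x
  Removable x = Pendant x × (x ∉ U ⊎ edgeAt x ⊆ U)
  Blocked x = Pendant x × x ∈ U × ¬ edgeAt x ⊆ U

  outerPendant? : Decidable OuterPendant
  outerPendant? x = pendant? x ×-dec ¬? (x ∈? U)

  outerHeavy? : Decidable OuterHeavy
  outerHeavy? x = ¬? (x ∈? U) ×-dec 2 ≤? deg F x

  removable? : Decidable Removable
  removable? x = pendant? x ×-dec (¬? (x ∈? U) ⊎-dec edgeAt x ⊆? U)

  blocked? : Decidable Blocked
  blocked? x = pendant? x ×-dec x ∈? U ×-dec ¬? (edgeAt x ⊆? U)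

  outerPendants outerHeavy heavy pendants removable blocked : List (Fin (n F))
  outerPendants = members outerPendant?
  outerHeavy = members outerHeavy?
  heavy = members (λ x → 2 ≤? deg F x)
  pendants = members pendant?
  removable = members removable?
  blocked = members blocked?

  crossing plain : List (Subset (n F))
  crossing = crossingEdges F U
  plain = edgesWhere (λ t → ¬? (t ⊆? U) ×-dec ¬? (Any.any? (_∈? t) outerPendants))

  core+outer≤v : ∣ U ∣ + length outerPendants + length outerHeavy ≤ n F
  core+outer≤v = begin
    ∣ U ∣ + length outerPendants + length outerHeavy
      ≡⟨ cong₂ _+_ (cong₂ _+_ (∣p∣≡length-members U) refl) refl ⟩
    length core + length outerPendants + length outerHeavy
      ≡⟨ +-assoc (length core) _ _ ⟩
    length core + (length outerPendants + length outerHeavy)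
      ≡⟨ cong (length core +_) (length-++ outerPendants) ⟨
    length core + length (outerPendants ++ outerHeavy)
      ≡⟨ length-++ core ⟨
    length (core ++ outerPendants ++ outerHeavy)
      ≤⟨ unique-⊆⇒length-≤
           (Unique.++⁺ (members! _) (Unique.++⁺ (members! _) (members! _) pendant∌heavy) core∌outer)
           (λ {x} _ → ∈-allFin x) ⟩
    length (allFin (n F)) ≡⟨ length-vertices ⟩
    n F ∎
    where
    open ≤-Reasoning
    core : List (Fin (n F))
    core = members (_∈? U)
    pendant∌heavy : Disjointˡ outerPendants outerHeavy
    pendant∌heavy (x∈P , x∈Y) = ¬pendant-heavy (proj₁ (∈-members⁻ _ x∈P)) (proj₂ (∈-members⁻ _ x∈Y))
    core∌outer : Disjointˡ core (outerPendants ++ outerHeavy)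
    core∌outer (x∈U , x∈PY) with ∈-++⁻ outerPendants x∈PY
    ... | inj₁ x∈P = proj₂ (∈-members⁻ _ x∈P) (∈-members⁻ _ x∈U)
    ... | inj₂ x∈Y = proj₁ (∈-members⁻ _ x∈Y) (∈-members⁻ _ x∈U)

  v≤heavy+pendants : n F ≤ highDegCount F + length pendants
  v≤heavy+pendants = begin
    n F                   ≡⟨ length-vertices ⟨
    length (allFin (n F)) ≤⟨ unique-⊆⇒length-≤ (Unique.allFin⁺ (n F)) heavy-or-pendant ⟩
    length (heavy ++ pendants) ≡⟨ length-++ heavy ⟩
    highDegCount F + length pendants ∎
    where
    open ≤-Reasoning
    heavy-or-pendant : allFin (n F) ⊆ˡ heavy ++ pendants
    heavy-or-pendant {x} _ with pendant-or-heavy x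
    ... | inj₁ p = ∈-++⁺ʳ heavy (∈-members⁺ pendant? p)
    ... | inj₂ h = ∈-++⁺ˡ (∈-members⁺ _ h)

  outerHeavy≤heavy : length outerHeavy ≤ highDegCount F
  outerHeavy≤heavy = unique-⊆⇒length-≤ (members! _) (∈-members⁺ _ ∘ proj₂ ∘ ∈-members⁻ _)

  pendants≤removable+blocked : length pendants ≤ length removable + length blocked
  pendants≤removable+blocked = ≤-trans (unique-⊆⇒length-≤ (members! _) removable-or-blocked)
                                        (≤-reflexive (length-++ removable))
    where
    removable-or-blocked : pendants ⊆ˡ removable ++ blocked
    removable-or-blocked {x} x∈ with ∈-members⁻ pendant? x∈ | x ∈? U
    ... | p | no x∉U = ∈-++⁺ˡ (∈-members⁺ _ (p , inj₁ x∉U))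
    ... | p | yes x∈U with edgeAt x ⊆? U
    ...   | yes ⊆U = ∈-++⁺ˡ (∈-members⁺ _ (p , inj₂ λ {y} → ⊆U {y}))
    ...   | no ⊈U = ∈-++⁺ʳ removable (∈-members⁺ _ (p , x∈U , ⊈U))

  edgeAt⁺ : ∀ {xs} → Unique xs → (∀ {x} → x ∈ˡ xs → Pendant x) → Unique (map edgeAt xs)
  edgeAt⁺ xs! xs-pendant = map⁺-injectiveOn edgeAt xs! λ p q → edgeAt-injectiveOn (xs-pendant p) (xs-pendant q)

  blocked≤plain : length blocked ≤ length plain
  blocked≤plain = ≤-trans (≤-reflexive (sym (length-map edgeAt blocked)))
    (unique-⊆⇒length-≤ (edgeAt⁺ (members! _) (proj₁ ∘ ∈-members⁻ _)) edgeAt-plain)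
    where
    edgeAt-plain : map edgeAt blocked ⊆ˡ plain
    edgeAt-plain t∈ with x , x∈ , refl ← ∈-map⁻ edgeAt t∈
                    with p , x∈U , ⊈U ← ∈-members⁻ blocked? x∈ =
      ∈-filter⁺ _ (edgeAt-∈ x) (⊈U , λ z∈t → let z , z∈P , z∈ = find z∈t
                                                 zp , z∉U = ∈-members⁻ outerPendant? z∈P in
        z∉U (subst (_∈ U) (pendants-apart (edgeAt-∈ x) x z (∈-edgeAt x) z∈ p zp) x∈U))

  module _ {S : List (Fin (n F))} (S⊆P : S ⊆ˡ outerPendants) where

    plain++edgesAt! : Unique S → Unique (plain ++ map edgeAt S)
    plain++edgesAt! S! = Unique.++⁺ (edgesWhere! _) (edgeAt⁺ S! (proj₁ ∘ ∈-members⁻ outerPendant? ∘ S⊆P))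
      λ (t∈plain , t∈S) → let x , x∈S , t≡ = ∈-map⁻ edgeAt t∈S in
        proj₂ (proj₂ (∈-edgesWhere⁻ _ t∈plain)) (lose (S⊆P x∈S) (subst (x ∈_) (sym t≡) (∈-edgeAt x)))

    ∈-plain++edgesAt⁻ : ∀ {t} → t ∈ˡ plain ++ map edgeAt S → t ∈ˡ edges F × ¬ t ⊆ U
    ∈-plain++edgesAt⁻ t∈ with ∈-++⁻ plain t∈
    ... | inj₁ t∈plain = let t∈F , t⊈U , _ = ∈-edgesWhere⁻ _ t∈plain in t∈F , t⊈U
    ... | inj₂ t∈S with x , x∈S , refl ← ∈-map⁻ edgeAt t∈S =
      edgeAt-∈ x , λ ⊆U → proj₂ (∈-members⁻ outerPendant? (S⊆P x∈S)) (⊆U (∈-edgeAt x))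

    length-plain++edgesAt : length (plain ++ map edgeAt S) ≡ length plain + length S
    length-plain++edgesAt = trans (length-++ plain) (cong (length plain +_) (length-map edgeAt S))

  crossing≡plain+outerPendants : length crossing ≡ length plain + length outerPendants
  crossing≡plain+outerPendants = ≤-antisym
    (≤-trans (unique-⊆⇒length-≤ (Unique.filter⁺ _ (simple F)) crossing⊆)
             (≤-reflexive (length-plain++edgesAt id)))
    (≤-trans (≤-reflexive (sym (length-plain++edgesAt id)))
      (unique-⊆⇒length-≤ (plain++edgesAt! id (members! _))
        λ t∈ → let t∈F , t⊈U = ∈-plain++edgesAt⁻ id t∈ in ∈-filter⁺ _ t∈F t⊈U))
    where
    crossing⊆ : crossing ⊆ˡ plain ++ map edgeAt outerPendants
    crossing⊆ {t} t∈ with ∈-filter⁻ (λ s → ¬? (s ⊆? U)) {xs = edges F} t∈ | Any.any? (_∈? t) outerPendants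
    ... | t∈F , t⊈U | no ¬P = ∈-++⁺ˡ (∈-filter⁺ _ t∈F (t⊈U , ¬P))
    ... | t∈F , _ | yes P with z , z∈P , z∈t ← find P =
      ∈-++⁺ʳ plain (subst (_∈ˡ map edgeAt outerPendants)
        (sym (pendant⇒edgeAt (proj₁ (∈-members⁻ outerPendant? z∈P)) t∈F z∈t)) (∈-map⁺ edgeAt z∈P))

  edges≤inner+crossing : e F ≤ eInd F U + length crossing
  edges≤inner+crossing = ≤-trans (unique-⊆⇒length-≤ (simple F) inner-or-crossing)
                                  (≤-reflexive (length-++ (filter (_⊆? U) (edges F))))
    where
    inner-or-crossing : edges F ⊆ˡ filter (_⊆? U) (edges F) ++ crossing
    inner-or-crossing {t} t∈F with t ⊆? U
    ... | yes ⊆U = ∈-++⁺ˡ (∈-filter⁺ (_⊆? U) t∈F ⊆U)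
    ... | no ⊈U = ∈-++⁺ʳ _ (∈-filter⁺ _ t∈F ⊈U)

  crossing≤edges : length crossing ≤ e F
  crossing≤edges = length-filter _ (edges F)

  module _ {k : ℕ} (v≡e+k : n F ≡ e F + k) where
    private
      P y d h : ℕ
      P = length outerPendants
      y = length outerHeavy
      d = length crossing
      h = highDegCount F

    outer≤crossing : k + eInd F U ≤ ∣ U ∣ → P + y ≤ d
    outer≤crossing deficiency = +-cancelˡ-≤ (k + eInd F U) _ _ (begin
      k + eInd F U + (P + y) ≤⟨ +-monoˡ-≤ (P + y) deficiency ⟩
      ∣ U ∣ + (P + y)        ≡⟨ +-assoc ∣ U ∣ P y ⟨
      ∣ U ∣ + P + y          ≤⟨ core+outer≤v ⟩
      n F                    ≡⟨ v≡e+k ⟩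
      e F + k                ≤⟨ +-monoˡ-≤ k edges≤inner+crossing ⟩
      eInd F U + d + k       ≡⟨ regroup (eInd F U) d k ⟩
      k + eInd F U + d       ∎)
      where
      open ≤-Reasoning
      regroup : ∀ a b c → a + b + c ≡ c + a + b
      regroup = solve-∀

    -- Few heavy vertices (condition (iii)) force many pendants, and these pay for the outer heavy ones.
    outerHeavy+outer≤crossing+removable : 4 * h + 4 * k ≤ e F → y + (P + y) ≤ d + length removable
    outerHeavy+outer≤crossing+removable few-heavy = begin
      y + (P + y)                ≡⟨ regroup y P ⟩
      y + y + P                  ≤⟨ +-monoˡ-≤ P (+-mono-≤ outerHeavy≤heavy outerHeavy≤heavy) ⟩
      h + h + P                  ≤⟨ +-monoˡ-≤ P (≤-trans (m≤m+n (h + h) h) 3h≤pendants) ⟩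
      length pendants + P        ≤⟨ +-monoˡ-≤ P (≤-trans pendants≤removable+blocked
                                                         (+-monoʳ-≤ (length removable) blocked≤plain)) ⟩
      length removable + length plain + P ≡⟨ +-assoc (length removable) _ P ⟩
      length removable + (length plain + P) ≡⟨ cong (length removable +_) crossing≡plain+outerPendants ⟨
      length removable + d       ≡⟨ +-comm (length removable) d ⟩
      d + length removable       ∎
      where
      open ≤-Reasoning
      regroup : ∀ y P → y + (P + y) ≡ y + y + P
      regroup = solve-∀
      regroup′ : ∀ h k → h + (h + h + h + (4 * k + k)) ≡ 4 * h + 4 * k + k
      regroup′ = solve-∀
      3h≤pendants : h + h + h ≤ length pendants
      3h≤pendants = +-cancelˡ-≤ h _ _ (begin
        h + (h + h + h)               ≤⟨ +-monoʳ-≤ h (m≤m+n (h + h + h) (4 * k + k)) ⟩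
        h + (h + h + h + (4 * k + k)) ≡⟨ regroup′ h k ⟩
        4 * h + 4 * k + k             ≤⟨ +-monoˡ-≤ k few-heavy ⟩
        e F + k                       ≡⟨ v≡e+k ⟨
        n F                           ≤⟨ v≤heavy+pendants ⟩
        h + length pendants           ∎)

  module Construction {S T : List (Fin (n F))} (S⊆P : S ⊆ˡ outerPendants) (S! : Unique S)
    (T⊆R : T ⊆ˡ removable) (T! : Unique T) where

    keptEdges lastEdges : List (Subset (n F))
    keptEdges = edgesWhere (λ t → ¬? (Any.any? (_∈? t) T))
    lastEdges = plain ++ map edgeAt S

    keptVertices outerVertices lastVertices : List (Fin (n F))
    keptVertices = members (λ x → ¬? (Any.any? (x ≟ᶠ_) T))
    outerVertices = outerPendants ++ outerHeavy
    lastVertices = outerHeavy ++ S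

    length-lastEdges : length lastEdges ≡ length plain + length S
    length-lastEdges = length-plain++edgesAt S⊆P

    edges≤kept+removed : e F ≤ length keptEdges + length T
    edges≤kept+removed = begin
      e F                                ≤⟨ unique-⊆⇒length-≤ (simple F) kept-or-removed ⟩
      length (keptEdges ++ map edgeAt T) ≡⟨ length-++ keptEdges ⟩
      length keptEdges + length (map edgeAt T) ≡⟨ cong (length keptEdges +_) (length-map edgeAt T) ⟩
      length keptEdges + length T        ∎
      where
      open ≤-Reasoning
      kept-or-removed : edges F ⊆ˡ keptEdges ++ map edgeAt T
      kept-or-removed {t} t∈F with Any.any? (_∈? t) T
      ... | no ∌T = ∈-++⁺ˡ (∈-filter⁺ _ t∈F ∌T)
      ... | yes ∋T with z , z∈T , z∈t ← find ∋T =
        ∈-++⁺ʳ keptEdges (subst (_∈ˡ map edgeAt T)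
          (sym (pendant⇒edgeAt (proj₁ (∈-members⁻ removable? (T⊆R z∈T))) t∈F z∈t)) (∈-map⁺ edgeAt z∈T))

    kept+removed≤v : length keptVertices + length T ≤ n F
    kept+removed≤v = begin
      length keptVertices + length T ≡⟨ length-++ keptVertices ⟨
      length (keptVertices ++ T)     ≤⟨ unique-⊆⇒length-≤
                                          (Unique.++⁺ (members! _) T! λ (x∉T , x∈T) → ∈-members⁻ _ x∉T x∈T)
                                          (λ {x} _ → ∈-allFin x) ⟩
      length (allFin (n F))          ≡⟨ length-vertices ⟩
      n F                            ∎
      where open ≤-Reasoning

    kept-of-kept : ∀ {t x} → t ∈ˡ keptEdges → x ∈ t → x ∈ˡ keptVertices
    kept-of-kept t∈ x∈t = ∈-members⁺ _ λ x∈T → proj₂ (∈-edgesWhere⁻ _ t∈) (lose x∈T x∈t)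

    kept-of-crossing : ∀ {t x} → t ∈ˡ edges F → ¬ t ⊆ U → x ∈ t → x ∈ U → x ∈ˡ keptVertices
    kept-of-crossing {t} {x} t∈F t⊈U x∈t x∈U =
      ∈-members⁺ _ λ x∈T → not-removable (∈-members⁻ removable? (T⊆R x∈T))
      where
      not-removable : ¬ Removable x
      not-removable (_ , inj₁ x∉U) = x∉U x∈U
      not-removable (p , inj₂ ⊆U) = t⊈U (subst (_⊆ U) (sym (pendant⇒edgeAt p t∈F x∈t)) ⊆U)

    outer-vertex : ∀ {x} → x ∉ U → x ∈ˡ outerVertices
    outer-vertex {x} x∉U with pendant-or-heavy x
    ... | inj₁ p = ∈-++⁺ˡ (∈-members⁺ outerPendant? (p , x∉U))
    ... | inj₂ h = ∈-++⁺ʳ outerPendants (∈-members⁺ outerHeavy? (x∉U , h))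

    last-of-last : ∀ {t x} → t ∈ˡ lastEdges → x ∈ t → x ∉ U → x ∈ˡ lastVertices
    last-of-last {t} {x} t∈ x∈t x∉U with pendant-or-heavy x | ∈-++⁻ plain t∈
    ... | inj₂ h | _ = ∈-++⁺ˡ (∈-members⁺ outerHeavy? (x∉U , h))
    ... | inj₁ p | inj₁ t∈plain =
      ⊥-elim (proj₂ (proj₂ (∈-edgesWhere⁻ _ t∈plain)) (lose (∈-members⁺ outerPendant? (p , x∉U)) x∈t))
    ... | inj₁ p | inj₂ t∈S with z , z∈S , refl ← ∈-map⁻ edgeAt t∈S =
      ∈-++⁺ʳ outerHeavy (subst (_∈ˡ S)
        (pendants-apart (edgeAt-∈ z) z x (∈-edgeAt z) x∈t
                        (proj₁ (∈-members⁻ outerPendant? (S⊆P z∈S))) p) z∈S)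

    module Configuration {H : Hyp} {m : ℕ} (Sf : Sunflower F H U m) (t : ℕ) (t<m : t < m) where
      open Sunflower Sf

      middle : List ℕ
      middle = applyUpTo suc t

      edgeList : List (ℕ × Subset (n F))
      edgeList = tagged 0 keptEdges ++ (tagged (suc t) lastEdges ++ cartesianProduct middle crossing)

      vertexList : List (ℕ × Fin (n F))
      vertexList = tagged 0 keptVertices ++ (tagged (suc t) lastVertices ++ cartesianProduct middle outerVertices)

      W : Subset (n H)
      W = fromList (map (petalᵛ Sf) vertexList)

      data Placed : ℕ × Subset (n F) → Set where
        in-kept   : ∀ {s} → s ∈ˡ keptEdges → Placed (0 , s)
        in-last   : ∀ {s} → s ∈ˡ lastEdges → Placed (suc t , s)
        in-middle : ∀ {i s} → i < t → s ∈ˡ crossing → Placed (suc i , s)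

      private
        ∈-middle⁻ : ∀ {q} → q ∈ˡ middle → ∃[ i ] (i < t × q ≡ suc i)
        ∈-middle⁻ = ∈-applyUpTo⁻ suc

      place : ∀ {p} → p ∈ˡ edgeList → Placed p
      place p∈ with ∈-++⁻ (tagged 0 keptEdges) p∈
      ... | inj₁ p∈kept with _ , s∈ , refl ← ∈-map⁻ _ p∈kept = in-kept s∈
      ... | inj₂ p∈rest with ∈-++⁻ (tagged (suc t) lastEdges) p∈rest
      ...   | inj₁ p∈last with _ , s∈ , refl ← ∈-map⁻ _ p∈last = in-last s∈
      ...   | inj₂ p∈middle = place-middle p∈middle
        where
        place-middle : ∀ {q s} → (q , s) ∈ˡ cartesianProduct middle crossing → Placed (q , s)
        place-middle p∈ with q∈ , s∈ ← ∈-cartesianProduct⁻ middle crossing p∈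
          with i , i<t , refl ← ∈-middle⁻ q∈ = in-middle i<t s∈

      edgeList! : Unique edgeList
      edgeList! = Unique.++⁺ (tagged! (edgesWhere! _))
        (Unique.++⁺ (tagged! (plain++edgesAt! S⊆P S!))
                    (Unique.cartesianProduct⁺ middle! (Unique.filter⁺ _ (simple F)))
                    last∌middle)
        kept∌rest
        where
        middle! : Unique middle
        middle! = Unique.applyUpTo⁺₁ suc t λ i<j _ → <⇒≢ i<j ∘ suc-injective
        middle-tag : ∀ {q s} → (q , s) ∈ˡ cartesianProduct middle crossing → ∃[ i ] (i < t × q ≡ suc i)
        middle-tag p∈ = ∈-middle⁻ (proj₁ (∈-cartesianProduct⁻ middle crossing p∈))
        last∌middle : Disjointˡ (tagged (suc t) lastEdges) (cartesianProduct middle crossing)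
        last∌middle {q , s} (p∈last , p∈middle) =
          let i , i<t , q≡1+i = middle-tag p∈middle in
          <⇒≢ i<t (suc-injective (trans (sym q≡1+i) (tag≡ p∈last)))
        kept∌rest : Disjointˡ (tagged 0 keptEdges)
                              (tagged (suc t) lastEdges ++ cartesianProduct middle crossing)
        kept∌rest {q , s} (p∈kept , p∈rest) with ∈-++⁻ (tagged (suc t) lastEdges) p∈rest
        ... | inj₁ p∈last = 0≢1+n (trans (sym (tag≡ p∈kept)) (tag≡ p∈last))
        ... | inj₂ p∈middle = 0≢1+n (trans (sym (tag≡ p∈kept)) (proj₂ (proj₂ (middle-tag p∈middle))))

      length-edgeList : length edgeList ≡ length keptEdges + (length lastEdges + t * length crossing)
      length-edgeList = begin
        length edgeList
          ≡⟨ length-++ (tagged 0 keptEdges) ⟩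
        length (tagged 0 keptEdges) + length (tagged (suc t) lastEdges ++ cartesianProduct middle crossing)
          ≡⟨ cong₂ _+_ (length-tagged 0 keptEdges) (length-++ (tagged (suc t) lastEdges)) ⟩
        length keptEdges + (length (tagged (suc t) lastEdges) + length (cartesianProduct middle crossing))
          ≡⟨ cong (length keptEdges +_) (cong₂ _+_ (length-tagged (suc t) lastEdges)
                                                  (length-cartesianProduct middle crossing)) ⟩
        length keptEdges + (length lastEdges + length middle * length crossing)
          ≡⟨ cong (λ l → length keptEdges + (length lastEdges + l * length crossing)) (length-applyUpTo suc t) ⟩
        length keptEdges + (length lastEdges + t * length crossing)
          ∎
        where open ≡-Reasoning

      length-vertexList : length vertexList ≡ length keptVertices + (length lastVertices + t * length outerVertices)
      length-vertexList = begin
        length vertexList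
          ≡⟨ length-++ (tagged 0 keptVertices) ⟩
        length (tagged 0 keptVertices) + length (tagged (suc t) lastVertices ++ cartesianProduct middle outerVertices)
          ≡⟨ cong₂ _+_ (length-tagged 0 keptVertices) (length-++ (tagged (suc t) lastVertices)) ⟩
        length keptVertices + (length (tagged (suc t) lastVertices) + length (cartesianProduct middle outerVertices))
          ≡⟨ cong (length keptVertices +_) (cong₂ _+_ (length-tagged (suc t) lastVertices)
                                                     (length-cartesianProduct middle outerVertices)) ⟩
        length keptVertices + (length lastVertices + length middle * length outerVertices)
          ≡⟨ cong (λ l → length keptVertices + (length lastVertices + l * length outerVertices))
                  (length-applyUpTo suc t) ⟩
        length keptVertices + (length lastVertices + t * length outerVertices)
          ∎
        where open ≡-Reasoning

      counted : ∀ {p} → p ∈ˡ edgeList → CountedEdge Sf p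
      counted p∈ with place p∈
      ... | in-kept s∈ = proj₁ (∈-edgesWhere⁻ _ s∈) , z≤n , λ 0≢0 → ⊥-elim (0≢0 refl)
      ... | in-last s∈ = let s∈F , s⊈U = ∈-plain++edgesAt⁻ S⊆P s∈ in s∈F , t<m , λ _ → s⊈U
      ... | in-middle i<t s∈ = let s∈F , s⊈U = ∈-filter⁻ _ {xs = edges F} s∈ in
        s∈F , ≤-trans i<t (<⇒≤ t<m) , λ _ → s⊈U

      private
        Covered : ℕ → Fin (n F) → Set
        Covered q x = petal q x ∈ˡ map (petalᵛ Sf) vertexList

        kept-covered : ∀ {x} → x ∈ˡ keptVertices → Covered 0 x
        kept-covered x∈ = ∈-map⁺ (petalᵛ Sf) (∈-++⁺ˡ (∈-map⁺ (0 ,_) x∈))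

        core-covered : ∀ {q s x} → q ≤ m → s ∈ˡ edges F → ¬ s ⊆ U → x ∈ s → x ∈ U → Covered q x
        core-covered q≤m s∈F s⊈U x∈s x∈U =
          subst (_∈ˡ map (petalᵛ Sf) vertexList) (sym (petal-on-core q≤m x∈U))
                (kept-covered (kept-of-crossing s∈F s⊈U x∈s x∈U))

        last-covered : ∀ {x} → x ∈ˡ lastVertices → Covered (suc t) x
        last-covered x∈ =
          ∈-map⁺ (petalᵛ Sf) (∈-++⁺ʳ (tagged 0 keptVertices) (∈-++⁺ˡ (∈-map⁺ (suc t ,_) x∈)))

        middle-covered : ∀ {i x} → i < t → x ∈ˡ outerVertices → Covered (suc i) x
        middle-covered i<t x∈ = ∈-map⁺ (petalᵛ Sf) (∈-++⁺ʳ (tagged 0 keptVertices)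
          (∈-++⁺ʳ (tagged (suc t) lastVertices) (∈-cartesianProduct⁺ (∈-applyUpTo⁺ suc i<t) x∈)))

      covered : ∀ {q s} → (q , s) ∈ˡ edgeList → ∀ {x} → x ∈ s → Covered q x
      covered p∈ {x} x∈s with place p∈ | x ∈? U
      ... | in-kept s∈ | _ = kept-covered (kept-of-kept s∈ x∈s)
      ... | in-last s∈ | yes x∈U = let s∈F , s⊈U = ∈-plain++edgesAt⁻ S⊆P s∈ in
        core-covered t<m s∈F s⊈U x∈s x∈U
      ... | in-last s∈ | no x∉U = last-covered (last-of-last s∈ x∈s x∉U)
      ... | in-middle i<t s∈ | yes x∈U = let s∈F , s⊈U = ∈-filter⁻ _ {xs = edges F} s∈ in
        core-covered (≤-trans i<t (<⇒≤ t<m)) s∈F s⊈U x∈s x∈U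
      ... | in-middle i<t s∈ | no x∉U = middle-covered i<t (outer-vertex x∉U)

      configuration-edges : length keptEdges + (length lastEdges + t * length crossing) ≤ eInd H W
      configuration-edges = ≤-trans (≤-reflexive (sym length-edgeList))
        (sunflower-induced-edges Sf edgeList vertexList edgeList! counted covered)

      configuration-vertices : ∣ W ∣ ≤ length keptVertices + (length lastVertices + t * length outerVertices)
      configuration-vertices = ≤-trans (∣fromList∣≤length (map (petalᵛ Sf) vertexList))
        (≤-reflexive (trans (length-map (petalᵛ Sf) vertexList) length-vertexList))

  configuration-within-budget : ∀ {H m k ee} → Sunflower F H U m → n F ≡ e F + k →
    ∀ t i j → t < m → i ≤ length outerPendants → j ≤ length removable →
    ee + j ≤ e F + (length plain + i + t * length crossing) →
    e F + (length outerHeavy + i + t * (length outerPendants + length outerHeavy)) ≤ ee + j →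
    ∃[ W ] (∣ W ∣ ≤ ee + k × ee ≤ eInd H W)
  configuration-within-budget {H} {k = k} {ee} Sf v≡e+k t i j t<m i≤P j≤R edges-fit vertices-fit =
    W , vertex-bound , edge-bound
    where
    open Construction (take⊆ i outerPendants) (Unique.take⁺ i (members! _))
                      (take⊆ j removable) (Unique.take⁺ j (members! _))
    open Configuration Sf t t<m
    |S|≡i : length (take i outerPendants) ≡ i
    |S|≡i = length-take-≤ outerPendants i≤P
    |T|≡j : length (take j removable) ≡ j
    |T|≡j = length-take-≤ removable j≤R
    P y : ℕ
    P = length outerPendants
    y = length outerHeavy
    edge-bound : ee ≤ eInd H W
    edge-bound = begin
      ee
        ≤⟨ a+j≤b+c∧b≤d+j⇒a≤d+c edges-fit (subst (λ j → e F ≤ length keptEdges + j) |T|≡j edges≤kept+removed) ⟩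
      length keptEdges + (length plain + i + t * length crossing)
        ≡⟨ cong (λ l → length keptEdges + (l + t * length crossing))
                (sym (trans length-lastEdges (cong (length plain +_) |S|≡i))) ⟩
      length keptEdges + (length lastEdges + t * length crossing)
        ≤⟨ configuration-edges ⟩
      eInd H W
        ∎
      where open ≤-Reasoning
    vertex-bound : ∣ W ∣ ≤ ee + k
    vertex-bound = begin
      ∣ W ∣
        ≤⟨ configuration-vertices ⟩
      length keptVertices + (length lastVertices + t * length outerVertices)
        ≡⟨ cong (length keptVertices +_) (cong₂ _+_ (trans (length-++ outerHeavy) (cong (y +_) |S|≡i))
                                                   (cong (t *_) (length-++ outerPendants))) ⟩
      length keptVertices + (y + i + t * (P + y))
        ≤⟨ b+j≤a+k∧a+c≤e+j⇒b+c≤e+k {a = e F} {e = ee} kept+j≤e+k vertices-fit ⟩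
      ee + k
        ∎
      where
      open ≤-Reasoning
      kept+j≤e+k : length keptVertices + j ≤ e F + k
      kept+j≤e+k = subst₂ (λ j v → length keptVertices + j ≤ v) |T|≡j v≡e+k kept+removed≤v

  sunflower-configuration : ∀ {G H : Hyp} {k r′ ee} →
    n F ≡ e F + k → 4 * highDegCount F + 4 * k ≤ e F → 1 ≤ k → k + eInd F U ≤ ∣ U ∣ → 2 * e F ≤ ee →
    (emb : Fin (suc r′) → Embedding F G) →
    (∀ i j → i <ᶠ j → ∀ x y → ((φ (emb i) x ≡ φ (emb j) y) ⇔ (x ≡ y × x ∈ U))) →
    (∀ {t} → t ∈ˡ edges G → ∃[ i ] ∃[ s ] (s ∈ˡ edges F × IsImage (φ (emb i)) s t)) →
    ee ≤ e G → Embedding G H → ∃[ W ] (∣ W ∣ ≤ ee + k × ee ≤ eInd H W)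
  sunflower-configuration {k = k} v≡e+k few-heavy 1≤k deficiency 2e≤ee emb meet from-petals ee≤eG ψ =
    let t , i , j , t<r′ , i≤P , j≤R , edges-fit , vertices-fit = petal-budget
          crossing≡plain+outerPendants (outer≤crossing v≡e+k deficiency)
          (outerHeavy+outer≤crossing+removable v≡e+k few-heavy) crossing≤edges 1≤e
          2e≤ee (≤-trans ee≤eG (sunflower-edges≤ emb meet from-petals))
    in configuration-within-budget (sunflower-in emb meet ψ) v≡e+k t i j t<r′ i≤P j≤R
                                   edges-fit vertices-fit
    where
    1≤e : 1 ≤ e F
    1≤e = ≤-trans 1≤k (≤-trans (m≤n*m k 4) (≤-trans (m≤n+m (4 * k) (4 * highDegCount F)) few-heavy))

private
  x≡x-y+y : ∀ x y → x ≡ x - y +ℤ y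
  x≡x-y+y = ℤ-solve-∀

pos-m-pos-n≡pos-o⇒m≡n+o : ∀ m n o → pos m - pos n ≡ pos o → m ≡ n + o
pos-m-pos-n≡pos-o⇒m≡n+o m n o eq = ℤ.+-injective (begin
  pos m                  ≡⟨ x≡x-y+y (pos m) (pos n) ⟩
  pos m - pos n +ℤ pos n ≡⟨ cong (_+ℤ pos n) eq ⟩
  pos o +ℤ pos n         ≡⟨ ℤ.pos-+ o n ⟨
  pos (o + n)            ≡⟨ cong pos (+-comm o n) ⟩
  pos (n + o)            ∎)
  where open ≡-Reasoning

pos-o≤pos-m-pos-n⇒o+n≤m : ∀ m n o → pos o ≤ℤ pos m - pos n → o + n ≤ m
pos-o≤pos-m-pos-n⇒o+n≤m m n o le = ℤ.drop‿+≤+ (begin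
  pos (o + n)            ≡⟨ ℤ.pos-+ o n ⟩
  pos o +ℤ pos n         ≤⟨ ℤ.+-monoˡ-≤ (pos n) le ⟩
  pos m - pos n +ℤ pos n ≡⟨ x≡x-y+y (pos m) (pos n) ⟨
  pos m                  ∎)
  where open ℤ.≤-Reasoning

lemma2p7 : (F : Hyp) → Eligible F → (ee : ℕ) → 1 ≤ ee → 2 * e F ≤ ee
    → (H : Hyp) → (r : ℕ) → 1 ≤ r
    → (∃[ G ] (IsSunflower r F G × ee ≤ e G × Contains H G))
    → ∃[ W ] (pos ∣ W ∣ ≤ℤ pos ee +ℤ Δ F × ee ≤ eInd H W)
lemma2p7 F (k , Δ≡k , 1≤k , _ , few-heavy , apart , deg≥1 , _) ee _ 2e≤ee H (suc r′) _
         (G , (U , _ , Δ≤ΔU , emb , _ , from-petals , meet) , ee≤eG , ψ) =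
  let W , |W|≤ee+k , ee≤ = PendantStructure.sunflower-configuration F U deg≥1 apart
        v≡e+k 4h+4k≤e 1≤k deficiency 2e≤ee emb meet from-petals ee≤eG ψ
  in W , subst (λ δ → pos ∣ W ∣ ≤ℤ pos ee +ℤ δ) (sym Δ≡k)
               (subst (pos ∣ W ∣ ≤ℤ_) (ℤ.pos-+ ee k) (+≤+ |W|≤ee+k)) , ee≤
  where
  v≡e+k : n F ≡ e F + k
  v≡e+k = pos-m-pos-n≡pos-o⇒m≡n+o (n F) (e F) k Δ≡k
  4h+4k≤e : 4 * highDegCount F + 4 * k ≤ e F
  4h+4k≤e = pos-o≤pos-m-pos-n⇒o+n≤m (e F) (4 * k) (4 * highDegCount F)
    (subst₂ (λ a b → a ≤ℤ pos (e F) - b) (sym (ℤ.pos-* 4 (highDegCount F))) (sym (ℤ.pos-* 4 k)) few-heavy)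
  deficiency : k + eInd F U ≤ ∣ U ∣
  deficiency = pos-o≤pos-m-pos-n⇒o+n≤m ∣ U ∣ (eInd F U) k (subst (_≤ℤ ΔU F U) Δ≡k Δ≤ΔU)
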